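{- Let $\mathcal{Q}:(A\wedge B)$ be an SSAT formula, where $A$ and $B$ are in conjunctive normal form and $A\wedge B$ contains only non-tautological clauses, and let $(\emptyset^p, \mathcal{I})$ be derived from it by interpolating S-resolution. If $I=\mathrm{true}$ is used within each application of rule (R'.2) in this derivation, then $Pr(\mathcal{Q}:(A\wedge\neg\mathcal{I})) = 0$. Likewise, if $I=\mathrm{false}$ is used within each application of rule (R'.2), then $Pr(\mathcal{Q}:(\mathcal{I}\wedge B)) = 0$.
   Context: An SSAT formula is $\mathcal{Q} : \varphi$ where $\mathcal{Q} = Q_1x_1\ldots Q_nx_n$ is a prefix of quantified propositional variables, each $Q_i$ being either $\exists$ or a randomized quantifier $\mathsf{R}^{p_i}$ with rational $0<p_i<1$, and $\varphi$ is a propositional formula with $\mathrm{Var}(\varphi)\subseteq\{x_1,\dots,x_n\}$. Its maximum probability of satisfaction is defined recursively: $Pr(\varepsilon:\varphi)$ is $0$ if $\varphi$ is equivalent to false and $1$ if equivalent to true; $Pr(\exists x\,\mathcal{Q}':\varphi) = \max(Pr(\mathcal{Q}':\varphi[\mathrm{true}/x]),Pr(\mathcal{Q}':\varphi[\mathrm{false}/x]))$; $Pr(\mathsf{R}^p x\,\mathcal{Q}':\varphi) = p\,Pr(\mathcal{Q}':\varphi[\mathrm{true}/x]) + (1-p)\,Pr(\mathcal{Q}':\varphi[\mathrm{false}/x])$. Sets: $V_A := \mathrm{Var}(A)\setminus\mathrm{Var}(B)$, $V_B := \mathrm{Var}(B)\setminus\mathrm{Var}(A)$, $V_{A,B}:=\mathrm{Var}(A)\cap\mathrm{Var}(B)$.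 A clause is a disjunction (identified with a set) of literals without repetitions; tautological means valid. $\mathcal{Q}(\psi)$ is the shortest prefix $Q_1x_1\ldots Q_ix_i$ of $\mathcal{Q}$ containing all variables of $\psi$. For a non-tautological clause $c$, $\mathrm{ff}_c$ is the unique assignment on $\mathrm{Var}(c)$ falsifying $c$. S-resolution (for $\varphi = A\wedge B$) derives annotated clauses $c^p$: (R.1) every clause $c$ of $\varphi$ gives $c^0$; (R.2) if $c$ is a non-tautological clause over variables of $\varphi$, $\mathcal{Q}(c)=Q_1x_1\ldots Q_ix_i$, and for every $\tau:\{x_1,\dots,x_i\}\to\{\mathrm{true},\mathrm{false}\}$ agreeing with $\mathrm{ff}_c$ on $\mathrm{Var}(c)$ the formula $\varphi[\tau(x_1)/x_1]\ldots[\tau(x_i)/x_i]$ is valid, derive $c^1$; (R.3) from $(c_1\vee\neg x)^{p_1}$, $(c_2\vee x)^{p_2}$, where $Qx$ is in $\mathcal{Q}$ but not in $\mathcal{Q}(c_1\vee c_2)$ and $c_1\vee c_2$ is non-tautological, derive $(c_1\vee c_2)^p$ with $p=\max(p_1,p_2)$ if $Q=\exists$, $p=p_xp_1+(1-p_x)p_2$ if $Q=\mathsf{R}^{p_x}$. Interpolating S-resolution derives pairs $(c^p, I)$ with $I$ a propositional formula: (R'.1) for a clause $c$ of $A$ derive $(c^0,\mathrm{false})$, for a clause $c$ of $B$ derive $(c^0,\mathrm{true})$; (R'.2) whenever $c^p$ is derivable by (R.2), derive $(c^p, I)$ for any propositional formula $I$ over $V_{A,B}$; (R'.3) from $((c_1\vee\neg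 x)^{p_1}, I_1)$ and $((c_2\vee x)^{p_2}, I_2)$ such that (R.3) yields $(c_1\vee c_2)^p$ from the two clauses, derive $((c_1\vee c_2)^p, I)$ where $I = I_1\vee I_2$ if $x\in V_A$, $I = I_1\wedge I_2$ if $x\in V_B$, and $I=(\neg x\vee I_1)\wedge(x\vee I_2)$ if $x\in V_{A,B}$. -}

module Defs where

open import Data.Nat using (ℕ; _≟_)
open import Data.Bool using (Bool; true; false; if_then_else_; not; _∧_; _∨_)
open import Data.Rational using (ℚ; 0ℚ; 1ℚ; _<_; _⊔_) renaming (_+_ to _+ℚ_; _*_ to _*ℚ_; _-_ to _-ℚ_)
open import Data.List using (List; []; _∷_; map; concatMap; filter; _++_)
open import Data.List.Relation.Unary.All using (All)
open import Data.List.Relation.Unary.Unique.Propositional using (Unique)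
open import Data.List.Membership.Propositional using (_∈_; _∉_)
open import Data.List.Membership.DecPropositional _≟_ using (_∈?_)
open import Data.Product using (_×_; proj₁; Σ; _,_)
open import Data.Sum using (_⊎_)
open import Data.Unit using (⊤)
open import Relation.Nullary using (¬_; yes; no)
open import Relation.Nullary.Decidable using (⌊_⌋)
open import Relation.Binary.PropositionalEquality using (_≡_; _≢_)

Var : Set
Var = ℕ

Assignment : Set
Assignment = Var → Bool

data PForm : Set where
  var : Var → PForm
  tt  : PForm
  ff  : PForm
  ¬ᶠ_ : PForm → PForm
  _∧ᶠ_ : PForm → PForm → PForm
  _∨ᶠ_ : PForm → PForm → PForm

infix 6 ¬ᶠ_
infixr 5 _∧ᶠ_
infixr 4 _∨ᶠ_

eval : Assignment → PForm → Bool
eval ρ (var x) = ρ x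
eval ρ tt = true
eval ρ ff = false
eval ρ (¬ᶠ φ) = not (eval ρ φ)
eval ρ (φ ∧ᶠ ψ) = eval ρ φ ∧ eval ρ ψ
eval ρ (φ ∨ᶠ ψ) = eval ρ φ ∨ eval ρ ψ

fv : PForm → List Var
fv (var x) = x ∷ []
fv tt = []
fv ff = []
fv (¬ᶠ φ) = fv φ
fv (φ ∧ᶠ ψ) = fv φ ++ fv ψ
fv (φ ∨ᶠ ψ) = fv φ ++ fv ψ

data Lit : Set where
  pos : Var → Lit
  neg : Var → Lit

litVar : Lit → Var
litVar (pos x) = x
litVar (neg x) = x

evalLit : Assignment → Lit → Bool
evalLit ρ (pos x) = ρ x
evalLit ρ (neg x) = not (ρ x)

-- a clause is a list of literals; the hypothesis "without repetitions"
-- is imposed separately via Unique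
Clause : Set
Clause = List Lit

CNF : Set
CNF = List Clause

varsC : Clause → List Var
varsC = map litVar

varsCNF : CNF → List Var
varsCNF = concatMap varsC

NonTautological : Clause → Set
NonTautological c = (x : Var) → pos x ∈ c → neg x ∈ c → Data.Empty.⊥
  where import Data.Empty

ProperClause : Clause → Set
ProperClause c = Unique c × NonTautological c

clauseForm : Clause → PForm
clauseForm [] = ff
clauseForm (l ∷ c) = litForm l ∨ᶠ clauseForm c
  where
  litForm : Lit → PForm
  litForm (pos x) = var x
  litForm (neg x) = ¬ᶠ var x

cnfForm : CNF → PForm
cnfForm [] = tt
cnfForm (c ∷ cs) = clauseForm c ∧ᶠ cnfForm cs

data Quant : Set where
  ∃q : Quant
  Rq : ℚ → Quant

Prefix : Set
Prefix = List (Var × Quant)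

prefixVars : Prefix → List Var
prefixVars = map proj₁

WFQuant : Quant → Set
WFQuant ∃q = ⊤
WFQuant (Rq p) = (0ℚ < p) × (p < 1ℚ)

WFPrefix : Prefix → Set
WFPrefix Q = Unique (prefixVars Q) × All (λ xq → WFQuant (Data.Product.proj₂ xq)) Q

update : Assignment → Var → Bool → Assignment
update ρ x b y = if ⌊ y ≟ x ⌋ then b else ρ y

-- Pr(Q : φ) where substitution of truth values is represented by
-- extending the assignment ρ
PrAux : Prefix → Assignment → PForm → ℚ
PrAux [] ρ φ = if eval ρ φ then 1ℚ else 0ℚ
PrAux ((x , ∃q) ∷ Q) ρ φ = PrAux Q (update ρ x true) φ ⊔ PrAux Q (update ρ x false) φ
PrAux ((x , Rq p) ∷ Q) ρ φ =
  (p *ℚ PrAux Q (update ρ x true) φ) +ℚ ((1ℚ -ℚ p) *ℚ PrAux Q (update ρ x false) φ)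

Pr : Prefix → PForm → ℚ
Pr Q φ = PrAux Q (λ _ → false) φ

-- Q(c): the variables x₁ … xᵢ of the shortest prefix of Q containing
-- all variables in the given list

cover : Prefix → List Var → List Var
cover Q [] = []
cover [] (_ ∷ _) = []
cover ((x , _) ∷ Q) ys@(_ ∷ _) = x ∷ cover Q (filter (λ y → Relation.Nullary.¬? (y ≟ x)) ys)

-- the quantifier bound to x in Q (first occurrence; only used when x ∈ Q)
quantOf : Prefix → Var → Quant
quantOf [] x = ∃q
quantOf ((y , q) ∷ Q) x = if ⌊ x ≟ y ⌋ then q else quantOf Q x

override : List Var → Assignment → Assignment → Assignment
override xs τ σ y = if ⌊ y ∈? xs ⌋ then τ y else σ y

R2Cond : Prefix → CNF → CNF → Clause → Set
R2Cond Q A B c =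
  ProperClause c ×
  ((y : Var) → y ∈ varsC c → y ∈ varsCNF (A ++ B)) ×
  ((τ : Assignment) → ((l : Lit) → l ∈ c → evalLit τ l ≡ false) →
     -- φ[τ(x₁)/x₁]…[τ(xᵢ)/xᵢ] is valid
     (σ : Assignment) → eval (override (cover Q (varsC c)) τ σ) (cnfForm (A ++ B)) ≡ true)

-- c = c₁ ∨ c₂ (as sets) where d₁ = c₁ ∨ ¬x and d₂ = c₂ ∨ x
IsResolvent : Var → Clause → Clause → Clause → Set
IsResolvent x d₁ d₂ c =
  ((l : Lit) → l ∈ c → (l ∈ d₁ × l ≢ neg x) ⊎ (l ∈ d₂ × l ≢ pos x)) ×
  ((l : Lit) → (l ∈ d₁ × l ≢ neg x) ⊎ (l ∈ d₂ × l ≢ pos x) → l ∈ c)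

resProb : Quant → ℚ → ℚ → ℚ
resProb ∃q p₁ p₂ = p₁ ⊔ p₂
resProb (Rq p) p₁ p₂ = (p *ℚ p₁) +ℚ ((1ℚ -ℚ p) *ℚ p₂)

resInterp : CNF → CNF → Var → PForm → PForm → PForm
resInterp A B x I₁ I₂ with x ∈? varsCNF A | x ∈? varsCNF B
... | yes _ | no _  = I₁ ∨ᶠ I₂
... | no _  | yes _ = I₁ ∧ᶠ I₂
... | yes _ | yes _ = ((¬ᶠ var x) ∨ᶠ I₁) ∧ᶠ (var x ∨ᶠ I₂)
... | no _  | no _  = I₁ ∧ᶠ I₂   -- unreachable: pivots occur in A ∧ B

-- Interpolating S-resolution: IDeriv Q A B c p I  means (c^p, I) is derivable
data IDeriv (Q : Prefix) (A B : CNF) : Clause → ℚ → PForm → Set where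
  axA : ∀ {c} → c ∈ A → IDeriv Q A B c 0ℚ ff
  axB : ∀ {c} → c ∈ B → IDeriv Q A B c 0ℚ tt
  r2  : ∀ {c} (I : PForm) → R2Cond Q A B c →
        ((y : Var) → y ∈ fv I → (y ∈ varsCNF A) × (y ∈ varsCNF B)) →
        IDeriv Q A B c 1ℚ I
  r3  : ∀ {d₁ d₂ c p₁ p₂ I₁ I₂} (x : Var) →
        IDeriv Q A B d₁ p₁ I₁ → IDeriv Q A B d₂ p₂ I₂ →
        neg x ∈ d₁ → pos x ∈ d₂ →
        IsResolvent x d₁ d₂ c → ProperClause c →
        x ∈ prefixVars Q → x ∉ cover Q (varsC c) →
        IDeriv Q A B c (resProb (quantOf Q x) p₁ p₂) (resInterp A B x I₁ I₂)

AllR2 : ∀ {Q A B c p I} → (PForm → Set) → IDeriv Q A B c p I → Set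
AllR2 P (axA _) = ⊤
AllR2 P (axB _) = ⊤
AllR2 P (r2 I _ _) = P I
AllR2 P (r3 _ d₁ d₂ _ _ _ _ _ _) = AllR2 P d₁ × AllR2 P d₂

-- Along an interpolating derivation every pair (c^p, I) satisfies an invariant
-- that ignores p: if all (R'.2) leaves use true, then A ∧ ¬c entails I; if all
-- of them use false, then I ∧ B ∧ ¬c is unsatisfiable.  An axiom (R'.1)
-- satisfies it because its clause is false under ¬c.  In a resolution step the
-- pivot x does not occur in the resolvent, so ¬c leaves x free.  If x occurs in
-- the side formula of the invariant (A, resp. B), the value of x selects the
-- premise whose clause is falsified, and that premise alone decides the
-- combined interpolant.  Otherwise neither the side formula nor the
-- interpolants mention x, so both premises apply, at the two values of x.
-- For c = ∅ the invariants make A ∧ ¬I, resp. I ∧ B, unsatisfiable, and an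
-- unsatisfiable formula has probability 0 under every prefix.  Neither the
-- probabilities, nor the side conditions of (R'.2), nor the well-formedness
-- hypotheses are needed.
module Submission where

open import Defs
open import Data.Nat using (_≟_)
open import Data.Rational using (ℚ; 0ℚ; 1ℚ) renaming (_-_ to _-ℚ_)
open import Data.Rational.Properties using (⊔-idem; *-zeroʳ; +-identityʳ)
open import Data.List using ([]; _∷_; _++_)
open import Data.List.Relation.Unary.All using (All)
open import Data.List.Relation.Unary.Any using (here; there)
open import Data.List.Membership.Propositional using (_∈_; _∉_)
open import Data.List.Membership.Propositional.Properties using (∈-map⁺; ∈-++⁻; ∈-++⁺ˡ; ∈-++⁺ʳ; ∈-filter⁺)
open import Data.List.Membership.DecPropositional _≟_ using (_∈?_)
open import Data.Product using (_×_; _,_; proj₁; proj₂)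
open import Data.Sum using (_⊎_; inj₁; inj₂; [_,_])
open import Data.Empty using (⊥)
open import Data.Bool using (true; false; not; _∧_; _∨_)
open import Data.Bool.Properties using (∧-conicalˡ; ∧-conicalʳ; ∧-zeroʳ; ∨-zeroʳ)
open import Relation.Nullary using (¬_; yes; no; ¬?; contradiction)
open import Function using (_∘_)
open import Relation.Binary.PropositionalEquality using (_≡_; refl; sym; trans; cong; cong₂; _≢_)

infix 4 _⊨_

_⊨_ : Assignment → PForm → Set
ρ ⊨ φ = eval ρ φ ≡ true

Falsifies : Assignment → Clause → Set
Falsifies ρ c = ∀ l → l ∈ c → evalLit ρ l ≡ false

falsifies-[] : ∀ ρ → Falsifies ρ []
falsifies-[] ρ l ()

true≢false : true ≢ false
true≢false ()

∨-≡true⁻ : ∀ a b → a ∨ b ≡ true → a ≡ true ⊎ b ≡ true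
∨-≡true⁻ true  b _ = inj₁ refl
∨-≡true⁻ false b h = inj₂ h

∧-not-≡false : ∀ a b → (a ≡ true → b ≡ true) → a ∧ not b ≡ false
∧-not-≡false false b _ = refl
∧-not-≡false true  b h rewrite h refl = refl

∧-≡false : ∀ a b → (a ≡ true → b ≡ true → ⊥) → a ∧ b ≡ false
∧-≡false false b     _ = refl
∧-≡false true  false _ = refl
∧-≡false true  true  h = contradiction refl (h refl)

update-≡ : ∀ ρ x b → update ρ x b x ≡ b
update-≡ ρ x b with x ≟ x
... | yes _  = refl
... | no x≢x = contradiction refl x≢x

update-≢ : ∀ ρ x b {y} → y ≢ x → update ρ x b y ≡ ρ y
update-≢ ρ x b {y} y≢x with y ≟ x
... | yes y≡x = contradiction y≡x y≢x
... | no _    = refl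

eval-cong : ∀ {ρ σ} φ → (∀ y → y ∈ fv φ → ρ y ≡ σ y) → eval ρ φ ≡ eval σ φ
eval-cong (var x)  h = h x (here refl)
eval-cong tt       h = refl
eval-cong ff       h = refl
eval-cong (¬ᶠ φ)   h = cong not (eval-cong φ h)
eval-cong (φ ∧ᶠ ψ) h =
  cong₂ _∧_ (eval-cong φ λ y m → h y (∈-++⁺ˡ m)) (eval-cong ψ λ y m → h y (∈-++⁺ʳ (fv φ) m))
eval-cong (φ ∨ᶠ ψ) h =
  cong₂ _∨_ (eval-cong φ λ y m → h y (∈-++⁺ˡ m)) (eval-cong ψ λ y m → h y (∈-++⁺ʳ (fv φ) m))

eval-update-∉ : ∀ ρ {x} b φ → x ∉ fv φ → eval (update ρ x b) φ ≡ eval ρ φ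
eval-update-∉ ρ {x} b φ x∉φ = eval-cong φ λ y y∈φ → update-≢ ρ x b λ { refl → x∉φ y∈φ }

fv-clauseForm : ∀ c {y} → y ∈ fv (clauseForm c) → y ∈ varsC c
fv-clauseForm (pos _ ∷ c) (here e)  = here e
fv-clauseForm (neg _ ∷ c) (here e)  = here e
fv-clauseForm (pos _ ∷ c) (there m) = there (fv-clauseForm c m)
fv-clauseForm (neg _ ∷ c) (there m) = there (fv-clauseForm c m)

fv-cnfForm : ∀ A {y} → y ∈ fv (cnfForm A) → y ∈ varsCNF A
fv-cnfForm (c ∷ A) m with ∈-++⁻ (fv (clauseForm c)) m
... | inj₁ m′ = ∈-++⁺ˡ (fv-clauseForm c m′)
... | inj₂ m′ = ∈-++⁺ʳ (varsC c) (fv-cnfForm A m′)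

eval-cnfForm-update-∉ : ∀ ρ {x} b A → x ∉ varsCNF A →
                        eval (update ρ x b) (cnfForm A) ≡ eval ρ (cnfForm A)
eval-cnfForm-update-∉ ρ b A x∉A = eval-update-∉ ρ b (cnfForm A) λ m → x∉A (fv-cnfForm A m)

eval-clauseForm-falsified : ∀ ρ c → Falsifies ρ c → eval ρ (clauseForm c) ≡ false
eval-clauseForm-falsified ρ []          _ = refl
eval-clauseForm-falsified ρ (pos x ∷ c) h rewrite h (pos x) (here refl) =
  eval-clauseForm-falsified ρ c λ l m → h l (there m)
eval-clauseForm-falsified ρ (neg x ∷ c) h rewrite h (neg x) (here refl) =
  eval-clauseForm-falsified ρ c λ l m → h l (there m)

eval-cnfForm-falsified : ∀ ρ A {c} → c ∈ A → Falsifies ρ c → eval ρ (cnfForm A) ≡ false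
eval-cnfForm-falsified ρ (c ∷ A) (here refl) h rewrite eval-clauseForm-falsified ρ c h = refl
eval-cnfForm-falsified ρ (c′ ∷ A) (there m) h
  rewrite eval-cnfForm-falsified ρ A m h = ∧-zeroʳ (eval ρ (clauseForm c′))

⊭-cnfForm : ∀ ρ A {c} → c ∈ A → Falsifies ρ c → ¬ (ρ ⊨ cnfForm A)
⊭-cnfForm ρ A c∈A ρ⊭c ρ⊨A = true≢false (trans (sym ρ⊨A) (eval-cnfForm-falsified ρ A c∈A ρ⊭c))

∈-cover : ∀ Q ys {y} → y ∈ ys → y ∈ prefixVars Q → y ∈ cover Q ys
∈-cover ((z , _) ∷ Q) (w ∷ ws) {y} y∈ys y∈Q with y ≟ z
... | yes y≡z = here y≡z
∈-cover ((z , _) ∷ Q) (w ∷ ws) y∈ys (here y≡z)  | no y≢z = contradiction y≡z y≢z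
∈-cover ((z , _) ∷ Q) (w ∷ ws) y∈ys (there y∈Q) | no y≢z =
  there (∈-cover Q _ (∈-filter⁺ (λ v → ¬? (v ≟ z)) y∈ys y≢z) y∈Q)

evalLit-update-≢ : ∀ ρ x b l → litVar l ≢ x → evalLit (update ρ x b) l ≡ evalLit ρ l
evalLit-update-≢ ρ x b (pos y) y≢x = update-≢ ρ x b y≢x
evalLit-update-≢ ρ x b (neg y) y≢x = cong not (update-≢ ρ x b y≢x)

falsifies-update-∉ : ∀ ρ {x} b c → x ∉ varsC c → Falsifies ρ c → Falsifies (update ρ x b) c
falsifies-update-∉ ρ {x} b c x∉c ρ⊭c l l∈c =
  trans (evalLit-update-≢ ρ x b l λ { refl → x∉c (∈-map⁺ litVar l∈c) }) (ρ⊭c l l∈c)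

resolvent-falsifies₁ : ∀ {ρ x d₁ d₂ c} → IsResolvent x d₁ d₂ c →
                       ρ x ≡ true → Falsifies ρ c → Falsifies ρ d₁
resolvent-falsifies₁ (_ , ⊆c) ρx ρ⊭c (pos y) m = ρ⊭c (pos y) (⊆c (pos y) (inj₁ (m , λ ())))
resolvent-falsifies₁ {x = x} (_ , ⊆c) ρx ρ⊭c (neg y) m with y ≟ x
... | yes refl rewrite ρx = refl
... | no y≢x = ρ⊭c (neg y) (⊆c (neg y) (inj₁ (m , λ { refl → y≢x refl })))

resolvent-falsifies₂ : ∀ {ρ x d₁ d₂ c} → IsResolvent x d₁ d₂ c →
                       ρ x ≡ false → Falsifies ρ c → Falsifies ρ d₂
resolvent-falsifies₂ (_ , ⊆c) ρx ρ⊭c (neg y) m = ρ⊭c (neg y) (⊆c (neg y) (inj₂ (m , λ ())))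
resolvent-falsifies₂ {x = x} (_ , ⊆c) ρx ρ⊭c (pos y) m with y ≟ x
... | yes refl = ρx
... | no y≢x = ρ⊭c (pos y) (⊆c (pos y) (inj₂ (m , λ { refl → y≢x refl })))

module _ (A B : CNF) {x : Var} {I₁ I₂ : PForm} where

  fv-resInterp : (P : Var → Set) → (x ∈ varsCNF A → x ∈ varsCNF B → P x) →
                 (∀ y → y ∈ fv I₁ → P y) → (∀ y → y ∈ fv I₂ → P y) →
                 ∀ y → y ∈ fv (resInterp A B x I₁ I₂) → P y
  fv-resInterp P Px P₁ P₂ y m with x ∈? varsCNF A | x ∈? varsCNF B
  ... | yes x∈A | yes x∈B with ∈-++⁻ (x ∷ fv I₁) m
  ...   | inj₁ (here refl)  = Px x∈A x∈B
  ...   | inj₁ (there m₁)   = P₁ y m₁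
  ...   | inj₂ (here refl)  = Px x∈A x∈B
  ...   | inj₂ (there m₂)   = P₂ y m₂
  fv-resInterp P Px P₁ P₂ y m | yes _ | no _ = [ P₁ y , P₂ y ] (∈-++⁻ (fv I₁) m)
  fv-resInterp P Px P₁ P₂ y m | no _  | yes _ = [ P₁ y , P₂ y ] (∈-++⁻ (fv I₁) m)
  fv-resInterp P Px P₁ P₂ y m | no _  | no _  = [ P₁ y , P₂ y ] (∈-++⁻ (fv I₁) m)

  resInterp-true : ∀ {ρ} → (ρ x ≡ true → ρ ⊨ I₁) → (ρ x ≡ false → ρ ⊨ I₂) →
                   (x ∉ varsCNF A → ρ ⊨ I₁ × ρ ⊨ I₂) → ρ ⊨ resInterp A B x I₁ I₂
  resInterp-true {ρ} h₁ h₂ local with x ∈? varsCNF A | x ∈? varsCNF B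
  ... | no x∉A | yes _ rewrite proj₁ (local x∉A) | proj₂ (local x∉A) = refl
  ... | no x∉A | no _  rewrite proj₁ (local x∉A) | proj₂ (local x∉A) = refl
  ... | yes _  | no _ with ρ x
  ...   | true  rewrite h₁ refl = refl
  ...   | false rewrite h₂ refl = ∨-zeroʳ (eval ρ I₁)
  resInterp-true {ρ} h₁ h₂ local | yes _ | yes _ with ρ x
  ...   | true  rewrite h₁ refl = refl
  ...   | false rewrite h₂ refl = refl

  resInterp-false : ∀ {ρ} → (ρ x ≡ true → ¬ ρ ⊨ I₁) → (ρ x ≡ false → ¬ ρ ⊨ I₂) →
                    (x ∉ varsCNF B → ¬ ρ ⊨ I₁ × ¬ ρ ⊨ I₂) → ¬ ρ ⊨ resInterp A B x I₁ I₂
  resInterp-false {ρ} h₁ h₂ local with x ∈? varsCNF A | x ∈? varsCNF B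
  ... | yes _ | no x∉B = [ proj₁ (local x∉B) , proj₂ (local x∉B) ] ∘ ∨-≡true⁻ (eval ρ I₁) _
  ... | no _  | no x∉B = proj₁ (local x∉B) ∘ ∧-conicalˡ _ _
  ... | no _  | yes _ with ρ x
  ...   | true  = h₁ refl ∘ ∧-conicalˡ _ _
  ...   | false = h₂ refl ∘ ∧-conicalʳ (eval ρ I₁) _
  resInterp-false {ρ} h₁ h₂ local | yes _ | yes _ with ρ x
  ...   | true  = h₁ refl ∘ ∧-conicalˡ _ _
  ...   | false = h₂ refl

PrAux-unsatisfiable : ∀ Q ρ φ → (∀ σ → eval σ φ ≡ false) → PrAux Q ρ φ ≡ 0ℚ
PrAux-unsatisfiable [] ρ φ unsat rewrite unsat ρ = refl
PrAux-unsatisfiable ((x , ∃q) ∷ Q) ρ φ unsat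
  rewrite PrAux-unsatisfiable Q (update ρ x true) φ unsat
        | PrAux-unsatisfiable Q (update ρ x false) φ unsat = ⊔-idem 0ℚ
PrAux-unsatisfiable ((x , Rq p) ∷ Q) ρ φ unsat
  rewrite PrAux-unsatisfiable Q (update ρ x true) φ unsat
        | PrAux-unsatisfiable Q (update ρ x false) φ unsat
        | *-zeroʳ p | *-zeroʳ (1ℚ -ℚ p) = +-identityʳ 0ℚ

module _ (Q : Prefix) (A B : CNF) where

  Shared : Var → Set
  Shared y = y ∈ varsCNF A × y ∈ varsCNF B

  fv-interpolant : ∀ {c p I} → IDeriv Q A B c p I → ∀ y → y ∈ fv I → Shared y
  fv-interpolant (axA _) y ()
  fv-interpolant (axB _) y ()
  fv-interpolant (r2 _ _ shared) = shared
  fv-interpolant (r3 x d₁ d₂ _ _ _ _ _ _) =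
    fv-resInterp A B Shared _,_ (fv-interpolant d₁) (fv-interpolant d₂)

  falsifies-premise₁ : ∀ {ρ x d₁ d₂ c} → IsResolvent x d₁ d₂ c →
                       x ∈ prefixVars Q → x ∉ cover Q (varsC c) →
                       Falsifies ρ c → Falsifies (update ρ x true) d₁
  falsifies-premise₁ {ρ} {x} {c = c} res x∈Q x∉Qc ρ⊭c =
    resolvent-falsifies₁ res (update-≡ ρ x true)
      (falsifies-update-∉ ρ true c (λ x∈c → x∉Qc (∈-cover Q (varsC c) x∈c x∈Q)) ρ⊭c)

  falsifies-premise₂ : ∀ {ρ x d₁ d₂ c} → IsResolvent x d₁ d₂ c →
                       x ∈ prefixVars Q → x ∉ cover Q (varsC c) →
                       Falsifies ρ c → Falsifies (update ρ x false) d₂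
  falsifies-premise₂ {ρ} {x} {c = c} res x∈Q x∉Qc ρ⊭c =
    resolvent-falsifies₂ res (update-≡ ρ x false)
      (falsifies-update-∉ ρ false c (λ x∈c → x∉Qc (∈-cover Q (varsC c) x∈c x∈Q)) ρ⊭c)

  A-entails-interpolant : ∀ {c p I} (d : IDeriv Q A B c p I) → AllR2 (_≡ tt) d →
                          ∀ ρ → Falsifies ρ c → ρ ⊨ cnfForm A → ρ ⊨ I
  A-entails-interpolant (axA c∈A) _ ρ ρ⊭c ρ⊨A = contradiction ρ⊨A (⊭-cnfForm ρ A c∈A ρ⊭c)
  A-entails-interpolant (axB _) _ _ _ _ = refl
  A-entails-interpolant (r2 _ _ _) refl _ _ _ = refl
  A-entails-interpolant (r3 x d₁ d₂ _ _ res _ x∈Q x∉Qc) (h₁ , h₂) ρ ρ⊭c ρ⊨A =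
    resInterp-true A B
      (λ ρx → A-entails-interpolant d₁ h₁ ρ (resolvent-falsifies₁ res ρx ρ⊭c) ρ⊨A)
      (λ ρx → A-entails-interpolant d₂ h₂ ρ (resolvent-falsifies₂ res ρx ρ⊭c) ρ⊨A)
      (λ x∉A → at-update x∉A d₁ h₁ (falsifies-premise₁ res x∈Q x∉Qc ρ⊭c)
             , at-update x∉A d₂ h₂ (falsifies-premise₂ res x∈Q x∉Qc ρ⊭c))
    where
    at-update : ∀ {b d p J} → x ∉ varsCNF A → (e : IDeriv Q A B d p J) → AllR2 (_≡ tt) e →
                Falsifies (update ρ x b) d → ρ ⊨ J
    at-update {b} {J = J} x∉A e h ρ′⊭d =
      trans (sym (eval-update-∉ ρ b J λ x∈J → x∉A (proj₁ (fv-interpolant e x x∈J))))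
            (A-entails-interpolant e h (update ρ x b) ρ′⊭d
              (trans (eval-cnfForm-update-∉ ρ b A x∉A) ρ⊨A))

  B-refutes-interpolant : ∀ {c p I} (d : IDeriv Q A B c p I) → AllR2 (_≡ ff) d →
                          ∀ ρ → Falsifies ρ c → ρ ⊨ cnfForm B → ¬ ρ ⊨ I
  B-refutes-interpolant (axA _) _ _ _ _ ()
  B-refutes-interpolant (axB c∈B) _ ρ ρ⊭c ρ⊨B _ = ⊭-cnfForm ρ B c∈B ρ⊭c ρ⊨B
  B-refutes-interpolant (r2 _ _ _) refl _ _ _ ()
  B-refutes-interpolant (r3 x d₁ d₂ _ _ res _ x∈Q x∉Qc) (h₁ , h₂) ρ ρ⊭c ρ⊨B =
    resInterp-false A B
      (λ ρx → B-refutes-interpolant d₁ h₁ ρ (resolvent-falsifies₁ res ρx ρ⊭c) ρ⊨B)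
      (λ ρx → B-refutes-interpolant d₂ h₂ ρ (resolvent-falsifies₂ res ρx ρ⊭c) ρ⊨B)
      (λ x∉B → at-update x∉B d₁ h₁ (falsifies-premise₁ res x∈Q x∉Qc ρ⊭c)
             , at-update x∉B d₂ h₂ (falsifies-premise₂ res x∈Q x∉Qc ρ⊭c))
    where
    at-update : ∀ {b d p J} → x ∉ varsCNF B → (e : IDeriv Q A B d p J) → AllR2 (_≡ ff) e →
                Falsifies (update ρ x b) d → ¬ ρ ⊨ J
    at-update {b} {J = J} x∉B e h ρ′⊭d ρ⊨J =
      B-refutes-interpolant e h (update ρ x b) ρ′⊭d
        (trans (eval-cnfForm-update-∉ ρ b B x∉B) ρ⊨B)
        (trans (eval-update-∉ ρ b J λ x∈J → x∉B (proj₂ (fv-interpolant e x x∈J))) ρ⊨J)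

corollary3p6 : (Q : Prefix) (A B : CNF) →
    WFPrefix Q →
    (∀ y → y ∈ varsCNF (A ++ B) → y ∈ prefixVars Q) →
    All ProperClause (A ++ B) →
    (p : ℚ) (I : PForm) (d : IDeriv Q A B [] p I) →
    (AllR2 (λ J → J ≡ tt) d → Pr Q (cnfForm A ∧ᶠ (¬ᶠ I)) ≡ 0ℚ) ×
    (AllR2 (λ J → J ≡ ff) d → Pr Q (I ∧ᶠ cnfForm B) ≡ 0ℚ)
corollary3p6 Q A B _ _ _ _ I d = A∧¬I-null , I∧B-null
  where
  A∧¬I-null : AllR2 (λ J → J ≡ tt) d → Pr Q (cnfForm A ∧ᶠ (¬ᶠ I)) ≡ 0ℚ
  A∧¬I-null leaves-tt = PrAux-unsatisfiable Q _ _ λ σ →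
    ∧-not-≡false _ _ (A-entails-interpolant Q A B d leaves-tt σ (falsifies-[] σ))

  I∧B-null : AllR2 (λ J → J ≡ ff) d → Pr Q (I ∧ᶠ cnfForm B) ≡ 0ℚ
  I∧B-null leaves-ff = PrAux-unsatisfiable Q _ _ λ σ →
    ∧-≡false _ _ λ σ⊨I σ⊨B → B-refutes-interpolant Q A B d leaves-ff σ (falsifies-[] σ) σ⊨B σ⊨I
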